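{- For all integers $a, b \geq 1$, $\sigma(K_{a,b} \boxtimes K_{a,b}) \geq ab$, where $K_{a,b}$ is the complete bipartite graph with parts of sizes $a$ and $b$.
   Context: Surrounding Cops and Robbers on a finite simple graph $G$ with $k \geq 1$ cops and one robber: the cops first choose starting vertices (several cops may share a vertex), then the robber chooses a starting vertex not occupied by a cop, and thereafter the cops and the robber alternate moves, the cops moving first. In a move, each player may move to an adjacent vertex or stay put; the robber may never move to, or remain on, a vertex occupied by a cop, so if a cop moves onto the robber's vertex the robber is compelled to move to a neighbouring vertex not occupied by a cop. The cops win if at any time every neighbour of the robber's vertex is occupied by a cop; the robber wins if he avoids this forever. Play is with perfect information. The surrounding cop number $\sigma(G)$ is the least number of cops for which the cops have a winning strategy. The strong product $G \boxtimes H$ has vertex set $V(G)\times V(H)$, with distinct $(g,h)$ and $(g',h')$ adjacent iff ($g=g'$ or $gg'\in E(G)$) and ($h=h'$ or $hh'\in E(H)$). -}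

module Defs where

open import Level using (0ℓ)
open import Data.Nat using (ℕ; zero; suc)
open import Data.Fin using (Fin; toℕ)
open import Data.Sum using (_⊎_; inj₁; inj₂)
open import Data.Product using (_×_; _,_; ∃; ∃-syntax; Σ)
open import Data.Unit using (⊤)
open import Data.Empty using (⊥)
open import Data.Vec using (Vec; tabulate)
open import Relation.Nullary using (¬_)
open import Relation.Binary.PropositionalEquality using (_≡_)

record SGraph : Set₁ where
  field
    V      : Set
    Adj    : V → V → Set
    irrefl : ∀ x → ¬ Adj x x
    sym    : ∀ x y → Adj x y → Adj y x

KAdj : (a b : ℕ) → Fin a ⊎ Fin b → Fin a ⊎ Fin b → Set
KAdj a b (inj₁ _) (inj₁ _) = ⊥
KAdj a b (inj₁ _) (inj₂ _) = ⊤
KAdj a b (inj₂ _) (inj₁ _) = ⊤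
KAdj a b (inj₂ _) (inj₂ _) = ⊥

K : ℕ → ℕ → SGraph
K a b = record
  { V = Fin a ⊎ Fin b
  ; Adj = KAdj a b
  ; irrefl = irr
  ; sym = sy
  }
  where
  irr : ∀ x → ¬ KAdj a b x x
  irr (inj₁ _) ()
  irr (inj₂ _) ()
  sy : ∀ x y → KAdj a b x y → KAdj a b y x
  sy (inj₁ _) (inj₂ _) _ = _
  sy (inj₂ _) (inj₁ _) _ = _

_⊠_ : SGraph → SGraph → SGraph
G ⊠ H = record
  { V = G.V × H.V
  ; Adj = A
  ; irrefl = λ x p → Data.Product.proj₁ p Relation.Binary.PropositionalEquality.refl
  ; sym = sy
  }
  where
  module G = SGraph G
  module H = SGraph H
  open Relation.Binary.PropositionalEquality using (refl; sym)
  A : G.V × H.V → G.V × H.V → Set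
  A (g , h) (g' , h') =
    ¬ ((g , h) ≡ (g' , h')) × (g ≡ g' ⊎ G.Adj g g') × (h ≡ h' ⊎ H.Adj h h')
  sy : ∀ x y → A x y → A y x
  sy (g , h) (g' , h') (ne , p , q) =
    (λ e → ne (sym e)) , f p , f' q
    where
    f : g ≡ g' ⊎ G.Adj g g' → g' ≡ g ⊎ G.Adj g' g
    f (inj₁ e) = inj₁ (sym e)
    f (inj₂ e) = inj₂ (G.sym _ _ e)
    f' : h ≡ h' ⊎ H.Adj h h' → h' ≡ h ⊎ H.Adj h' h
    f' (inj₁ e) = inj₁ (sym e)
    f' (inj₂ e) = inj₂ (H.sym _ _ e)

module Game (G : SGraph) (k : ℕ) where
  open SGraph G

  CAdj : V → V → Set
  CAdj x y = x ≡ y ⊎ Adj x y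

  Config : Set
  Config = Fin k → V

  Occupied : Config → V → Set
  Occupied c v = ∃[ i ] c i ≡ v

  Surrounded : Config → V → Set
  Surrounded c v = ∀ w → Adj v w → Occupied c w

  -- A cop strategy: initial placement, and for each t the new placement
  -- (cops' (t+1)-th move) as a function of the robber's positions r₀ … r_t
  -- (perfect information; the cops' own past moves are determined by these).
  record CopStrategy : Set where
    field
      start : Config
      move  : (t : ℕ) → Vec V (suc t) → Config

  history : (ℕ → V) → (t : ℕ) → Vec V (suc t)
  history r t = tabulate (λ i → r (toℕ i))

  copsAt : CopStrategy → (ℕ → V) → ℕ → Config
  copsAt s r zero    = CopStrategy.start s
  copsAt s r (suc t) = CopStrategy.move s t (history r t)

  CopsLegal : CopStrategy → Set
  CopsLegal s = ∀ (r : ℕ → V) (t : ℕ) (i : Fin k) →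
    CAdj (copsAt s r t i) (copsAt s r (suc t) i)

  -- robber sequence r is a legal play against s: r 0 is the robber's start
  -- (chosen after the cops); r (suc t) is his answer to the cops' move to
  -- copsAt s r (suc t).
  RobberLegal : CopStrategy → (ℕ → V) → Set
  RobberLegal s r =
    ¬ Occupied (copsAt s r 0) (r 0) ×
    (∀ t → CAdj (r t) (r (suc t)) × ¬ Occupied (copsAt s r (suc t)) (r (suc t)))

  -- the cops surround the robber at some time: either after the robber's
  -- t-th move (config copsAt t, robber r t) or after the cops' (t+1)-th move.
  Captured : CopStrategy → (ℕ → V) → Set
  Captured s r = ∃[ t ] (Surrounded (copsAt s r t) (r t)
                         ⊎ Surrounded (copsAt s r (suc t)) (r t))

  Winning : CopStrategy → Set
  Winning s = CopsLegal s × (∀ r → RobberLegal s r → Captured s r)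

  CopsWin : Set
  CopsWin = ∃[ s ] Winning s

CopsWin : SGraph → ℕ → Set
CopsWin G k = Game.CopsWin G k

σ-≥ : SGraph → ℕ → Set
σ-≥ G m = ∀ (k : ℕ) → 1 Data.Nat.≤ k → CopsWin G k → m Data.Nat.≤ k

-- Write A and B for the two parts of K_{a,b}.  In the strong product the
-- "blocks" A × B and B × A each have ab vertices, and every vertex of A × B
-- is adjacent to every vertex of B × A (both coordinates move across the
-- bipartition).  Against k < ab cops each block always contains a vertex
-- free of cops, so the robber can alternate between the two blocks: he always
-- stands on a free vertex of one block, and whatever the cops do he has a free
-- neighbour in the other block.  Hence he is never surrounded.
module Submission where

open import Defs
open import Data.Nat using (ℕ; _≤_; _*_; zero; suc; _<_)
open import Data.Nat.Properties using (_≤?_; ≰⇒>; <⇒≱)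
open import Data.Fin using (Fin; toℕ; fromℕ; inject₁; remQuot; combine)
  renaming (zero to fzero; suc to fsuc)
open import Data.Fin.Properties
  using (any?; all?; ¬∀⟶∃¬; injective⇒≤; toℕ-inject₁; toℕ-fromℕ; combine-remQuot)
  renaming (_≟_ to _≟ᶠ_)
open import Data.Sum using (_⊎_; inj₁; inj₂)
open import Data.Sum.Properties using () renaming (≡-dec to ⊎-≡-dec)
open import Data.Product using (_,_; ∃-syntax; proj₁; proj₂; uncurry)
open import Data.Product.Properties using () renaming (≡-dec to ×-≡-dec)
open import Data.Bool using (Bool; true; false; not)
open import Data.Empty using (⊥-elim)
open import Data.Vec using (Vec; _∷_; _∷ʳ_; [_]; tabulate)
open import Data.Vec.Properties using (tabulate-cong)
open import Function.Definitions using (Injective)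
open import Relation.Nullary using (¬_; yes; no; ¬?)
open import Relation.Nullary.Decidable using (decidable-stable)
open import Relation.Binary.Definitions using (DecidableEquality)
open import Relation.Binary.PropositionalEquality
  using (_≡_; _≢_; refl; sym; trans; cong; cong₂; subst; subst₂; module ≡-Reasoning)

-- If each of n distinct values is hit by one of k values, then n ≤ k:
-- choosing a hitting index for every target is an injection Fin n → Fin k.
covering-bound : ∀ {V : Set} {k n} (c : Fin k → V) (e : Fin n → V) →
                 Injective _≡_ _≡_ e → (∀ j → ∃[ i ] c i ≡ e j) → n ≤ k
covering-bound c e e-inj cover =
  injective⇒≤ {f = λ j → proj₁ (cover j)} λ {j} {j′} same →
    e-inj (trans (sym (proj₂ (cover j)))
                 (trans (cong c same) (proj₂ (cover j′))))

uncovered : ∀ {V : Set} {k n} → DecidableEquality V → k < n →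
            (c : Fin k → V) (e : Fin n → V) → Injective _≡_ _≡_ e →
            ∃[ j ] (∀ i → c i ≢ e j)
uncovered {k = k} _≟_ k<n c e e-inj
  with any? (λ j → all? (λ i → ¬? (c i ≟ e j)))
... | yes free = free
... | no ¬free = ⊥-elim (<⇒≱ k<n (covering-bound c e e-inj cover))
  where
  cover : ∀ j → ∃[ i ] c i ≡ e j
  cover j with ¬∀⟶∃¬ k _ (λ i → ¬? (c i ≟ e j)) (λ allFree → ¬free (j , allFree))
  ... | i , ¬¬hit = i , decidable-stable (c i ≟ e j) ¬¬hit

prefix : ∀ {A : Set} → (ℕ → A) → (t : ℕ) → Vec A (suc t)
prefix r t = tabulate (λ i → r (toℕ i))

tabulate-∷ʳ : ∀ {A : Set} n (f : Fin (suc n) → A) →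
              tabulate f ≡ tabulate (λ i → f (inject₁ i)) ∷ʳ f (fromℕ n)
tabulate-∷ʳ zero    f = refl
tabulate-∷ʳ (suc n) f = cong (f fzero ∷_) (tabulate-∷ʳ n (λ i → f (fsuc i)))

prefix-suc : ∀ {A : Set} (r : ℕ → A) t → prefix r (suc t) ≡ prefix r t ∷ʳ r (suc t)
prefix-suc r t = begin
  prefix r (suc t)
    ≡⟨ tabulate-∷ʳ (suc t) (λ i → r (toℕ i)) ⟩
  tabulate (λ i → r (toℕ (inject₁ i))) ∷ʳ r (toℕ (fromℕ (suc t)))
    ≡⟨ cong₂ _∷ʳ_ (tabulate-cong (λ i → cong r (toℕ-inject₁ i)))
                  (cong r (toℕ-fromℕ (suc t))) ⟩
  prefix r t ∷ʳ r (suc t) ∎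
  where open ≡-Reasoning

-- Course-of-values recursion for sequences: the next term may depend on the
-- whole history.  The history is built alongside the sequence itself.
module Feedback {A : Set} (x₀ : A) (step : (t : ℕ) → Vec A (suc t) → A) where
  mutual
    seq : ℕ → A
    seq zero    = x₀
    seq (suc t) = step t (past t)

    past : (t : ℕ) → Vec A (suc t)
    past zero    = [ x₀ ]
    past (suc t) = past t ∷ʳ seq (suc t)

  prefix-seq : ∀ t → prefix seq t ≡ past t
  prefix-seq zero    = refl
  prefix-seq (suc t) = trans (prefix-suc seq t) (cong (_∷ʳ seq (suc t)) (prefix-seq t))

  seq-suc : ∀ t → seq (suc t) ≡ step t (prefix seq t)
  seq-suc t = cong (step t) (sym (prefix-seq t))

module Evasion (G : SGraph) (k : ℕ) where
  open SGraph G using (V; Adj)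
  open Game G k

  record Dodging : Set where
    field
      dodge  : Bool → Config → V
      free   : ∀ side c → ¬ Occupied c (dodge side c)
      joined : ∀ side c c′ → Adj (dodge side c) (dodge (not side) c′)

  -- With dodging responses the robber alternates sides and is never caught.
  module Robber (D : Dodging) (s : CopStrategy) where
    open Dodging D
    open CopStrategy s

    side : ℕ → Bool
    side zero    = true
    side (suc t) = not (side t)

    open Feedback (dodge true start) (λ t h → dodge (side (suc t)) (move t h))
      public renaming (seq to play)

    play-dodges : ∀ t → play t ≡ dodge (side t) (copsAt s play t)
    play-dodges zero    = refl
    play-dodges (suc t) = seq-suc t

    unoccupied : ∀ t → ¬ Occupied (copsAt s play t) (play t)
    unoccupied t (i , here) =
      free (side t) (copsAt s play t) (i , trans here (play-dodges t))

    legal : RobberLegal s play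
    legal = unoccupied 0 , λ t →
      inj₂ (subst₂ Adj (sym (play-dodges t)) (sym (play-dodges (suc t)))
                      (joined (side t) _ _)) ,
      unoccupied (suc t)

    -- Whatever the cops' configuration c, the dodging vertex of the other
    -- side is a free neighbour of the robber.
    never-surrounded : ∀ c t → ¬ Surrounded c (play t)
    never-surrounded c t surrounded =
      free (not (side t)) c (surrounded _ neighbour)
      where
      neighbour : Adj (play t) (dodge (not (side t)) c)
      neighbour = subst (λ v → Adj v (dodge (not (side t)) c)) (sym (play-dodges t))
                        (joined (side t) (copsAt s play t) c)

    escapes : ¬ Captured s play
    escapes (t , inj₁ surrounded) = never-surrounded _ t surrounded
    escapes (t , inj₂ surrounded) = never-surrounded _ t surrounded

  cops-lose : Dodging → ¬ Defs.CopsWin G k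
  cops-lose D (s , _ , wins) = escapes (wins play legal)
    where open Robber D s

module Square (a b : ℕ) where
  G : SGraph
  G = K a b ⊠ K a b

  open SGraph G using (V; Adj)

  _≟_ : DecidableEquality V
  _≟_ = ×-≡-dec part-≟ part-≟
    where
    part-≟ : DecidableEquality (Fin a ⊎ Fin b)
    part-≟ = ⊎-≡-dec _≟ᶠ_ _≟ᶠ_

  block : Bool → Fin a → Fin b → V
  block true  i j = inj₁ i , inj₂ j
  block false i j = inj₂ j , inj₁ i

  blocks-joined : ∀ side i j i′ j′ → Adj (block side i j) (block (not side) i′ j′)
  blocks-joined true  _ _ _ _ = (λ ()) , inj₂ _ , inj₂ _
  blocks-joined false _ _ _ _ = (λ ()) , inj₂ _ , inj₂ _

  enum : Bool → Fin (a * b) → V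
  enum side m = uncurry (block side) (remQuot {a} b m)

  enum-injective : ∀ side → Injective _≡_ _≡_ (enum side)
  enum-injective side {m} {m′} same = begin
    m                                  ≡⟨ sym (combine-remQuot {a} b m) ⟩
    uncurry combine (remQuot {a} b m)  ≡⟨ cong (uncurry combine) (block-injective side same) ⟩
    uncurry combine (remQuot {a} b m′) ≡⟨ combine-remQuot {a} b m′ ⟩
    m′                                 ∎
    where
    open ≡-Reasoning
    block-injective : ∀ side {i i′ j j′} → block side i j ≡ block side i′ j′ →
                      (i , j) ≡ (i′ , j′)
    block-injective true  refl = refl
    block-injective false refl = refl

  dodging : ∀ {k} → k < a * b → Evasion.Dodging G k
  dodging {k} k<ab = record
    { dodge  = λ side c → enum side (proj₁ (free-in side c))
    ; free   = λ side c (i , hit) → proj₂ (free-in side c) i hit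
    ; joined = λ side c c′ → blocks-joined side _ _ _ _
    }
    where
    free-in : ∀ side (c : Game.Config G k) → ∃[ j ] (∀ i → c i ≢ enum side j)
    free-in side c = uncovered _≟_ k<ab c (enum side) (enum-injective side)

theorem21 : ∀ (a b : ℕ) → 1 ≤ a → 1 ≤ b → σ-≥ (K a b ⊠ K a b) (a * b)
theorem21 a b _ _ k _ copsWin with a * b ≤? k
... | yes ab≤k = ab≤k
... | no  ab≰k = ⊥-elim (Evasion.cops-lose (K a b ⊠ K a b) k
                           (Square.dodging a b (≰⇒> ab≰k)) copsWin)
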